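{- For every nonempty set $P$ of prime numbers, none of the logics $\vdash^P_{\mathbf{LL}}$, $\vdash^P_{\mathbf{MALL}}$, $\vdash^P_{\mathbf{FL}_e}$, $\vdash^P_{\mathbf{RL}_e}$ has the Craig interpolation property.
   Context: For an abelian group $\mathbf G=\langle G,\cdot,{}^{ -1},1\rangle$, let $\bot,\top\notin G$ be new elements and order $G\cup\{\bot,\top\}$ by $\bot<a<\top$ for all $a\in G$, with distinct elements of $G$ incomparable. Extend the multiplication of $\mathbf G$ by $a\cdot\top=\top\cdot a=\top$ for $a\in G\cup\{\top\}$ and $b\cdot\bot=\bot\cdot b=\bot$ for all $b$, let $a\to c=\max\{b:ab\le c\}$, $0:=1$, $!a:=a\wedge1$. For $S\subseteq\{0,\bot,\top,!\}$, $\mathrm R^S(\mathbf G)$ is the reduct of $\langle G\cup\{\bot,\top\},\wedge,\vee,\cdot,\to,1,0,\bot,\top,!\rangle$ to the language $\{\wedge,\vee,\cdot,\to,1\}\cup S$. $\mathsf Q_P$ is the class of abelian groups satisfying $x^p\approx1\Rightarrow x\approx1$ for all $p\in P$; $\mathsf K_P^S$ is the class of algebras isomorphic to $\mathrm R^S(\mathbf G)$ for some $\mathbf G\in\mathsf Q_P$ or to a trivial algebra of that language; $\mathsf V_P^S$ is the variety generated by $\mathsf K_P^S$. The logics are defined over the languages $\{\wedge,\vee,\cdot,\to,1\}\cup S$ with $S=\{0,\bot,\top,!\}$, $\{0,\bot,\top\}$, $\{0\}$, $\emptyset$ for $\vdash^P_{\mathbf{LL}},\vdash^P_{\mathbf{MALL}},\vdash^P_{\mathbf{FL}_e},\vdash^P_{\mathbf{RL}_e}$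 respectively, by: $\Gamma\vdash\varphi$ iff for every $\mathbf A\in\mathsf V_P^S$ and every assignment $h$ into $\mathbf A$, if $h(\gamma)\wedge1=1$ for all $\gamma\in\Gamma$ then $h(\varphi)\wedge1=1$. (These are the axiomatic extensions of linear logic, multiplicative-additive linear logic, the full Lambek calculus with exchange, and its $0$-free fragment corresponding to these varieties.) A logic $\vdash$ has the Craig interpolation property if whenever $\vdash\varphi\to\psi$ there is a formula $\delta$ all of whose variables occur in both $\varphi$ and $\psi$ with $\vdash\varphi\to\delta$ and $\vdash\delta\to\psi$. -}

module Defs where

open import Level using (0ℓ)
open import Data.Nat using (ℕ; zero; suc)
open import Data.Nat.Primality using (Prime)
open import Data.Bool using (Bool; true; false; T)
open import Data.Product using (Σ; _×_; ∃)
open import Data.Sum using (_⊎_)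
open import Data.List using (List; [])
open import Data.List.Relation.Unary.All using (All)
open import Relation.Binary.PropositionalEquality using (_≡_)
open import Relation.Nullary using (¬_)
open import Algebra.Bundles using (AbelianGroup)

data Lang : Set where
  LL MALL FLe RLe : Lang

has0 : Lang → Bool
has0 RLe = false
has0 _   = true

hasBT : Lang → Bool
hasBT LL   = true
hasBT MALL = true
hasBT _    = false

hasBang : Lang → Bool
hasBang LL = true
hasBang _  = false

data Fm (L : Lang) : Set where
  var  : ℕ → Fm L
  _∧ᶠ_ _∨ᶠ_ _·ᶠ_ _⇒ᶠ_ : Fm L → Fm L → Fm L
  oneᶠ : Fm L
  zeroᶠ : T (has0 L) → Fm L
  botᶠ topᶠ : T (hasBT L) → Fm L
  bangᶠ : T (hasBang L) → Fm L → Fm L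

data Occurs {L : Lang} (n : ℕ) : Fm L → Set where
  here : Occurs n (var n)
  ∧l : ∀ {a b} → Occurs n a → Occurs n (a ∧ᶠ b)
  ∧r : ∀ {a b} → Occurs n b → Occurs n (a ∧ᶠ b)
  ∨l : ∀ {a b} → Occurs n a → Occurs n (a ∨ᶠ b)
  ∨r : ∀ {a b} → Occurs n b → Occurs n (a ∨ᶠ b)
  ·l : ∀ {a b} → Occurs n a → Occurs n (a ·ᶠ b)
  ·r : ∀ {a b} → Occurs n b → Occurs n (a ·ᶠ b)
  ⇒l : ∀ {a b} → Occurs n a → Occurs n (a ⇒ᶠ b)
  ⇒r : ∀ {a b} → Occurs n b → Occurs n (a ⇒ᶠ b)
  bng : ∀ {t a} → Occurs n a → Occurs n (bangᶠ t a)

record Alg (L : Lang) : Set₁ where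
  field
    Carrier : Set
    meet join mul res : Carrier → Carrier → Carrier
    one : Carrier
    zer : T (has0 L) → Carrier
    bot top : T (hasBT L) → Carrier
    bang : T (hasBang L) → Carrier → Carrier

  eval : (ℕ → Carrier) → Fm L → Carrier
  eval h (var n)     = h n
  eval h (a ∧ᶠ b)    = meet (eval h a) (eval h b)
  eval h (a ∨ᶠ b)    = join (eval h a) (eval h b)
  eval h (a ·ᶠ b)    = mul (eval h a) (eval h b)
  eval h (a ⇒ᶠ b)    = res (eval h a) (eval h b)
  eval h oneᶠ        = one
  eval h (zeroᶠ t)   = zer t
  eval h (botᶠ t)    = bot t
  eval h (topᶠ t)    = top t
  eval h (bangᶠ t a) = bang t (eval h a)

  Sat : Fm L → Fm L → Set
  Sat s t = ∀ (h : ℕ → Carrier) → eval h s ≡ eval h t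

module _ (G : AbelianGroup 0ℓ 0ℓ) where
  open AbelianGroup G renaming (Carrier to |G|)

  data Ext : Set where
    ⊥ₑ ⊤ₑ : Ext
    el : |G| → Ext

  data _≃ₑ_ : Ext → Ext → Set where
    ⊥≃ : ⊥ₑ ≃ₑ ⊥ₑ
    ⊤≃ : ⊤ₑ ≃ₑ ⊤ₑ
    el≃ : ∀ {a b} → a ≈ b → el a ≃ₑ el b

  data _≤ₑ_ : Ext → Ext → Set where
    ⊥≤ : ∀ {x} → ⊥ₑ ≤ₑ x
    ≤⊤ : ∀ {x} → x ≤ₑ ⊤ₑ
    el≤ : ∀ {a b} → a ≈ b → el a ≤ₑ el b

  mulₑ : Ext → Ext → Ext
  mulₑ ⊥ₑ y = ⊥ₑ
  mulₑ ⊤ₑ ⊥ₑ = ⊥ₑ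
  mulₑ ⊤ₑ ⊤ₑ = ⊤ₑ
  mulₑ ⊤ₑ (el b) = ⊤ₑ
  mulₑ (el a) ⊥ₑ = ⊥ₑ
  mulₑ (el a) ⊤ₑ = ⊤ₑ
  mulₑ (el a) (el b) = el (a ∙ b)

  IsMeet : Ext → Ext → Ext → Set
  IsMeet x y z = z ≤ₑ x × z ≤ₑ y × (∀ w → w ≤ₑ x → w ≤ₑ y → w ≤ₑ z)

  IsJoin : Ext → Ext → Ext → Set
  IsJoin x y z = x ≤ₑ z × y ≤ₑ z × (∀ w → x ≤ₑ w → y ≤ₑ w → z ≤ₑ w)

  IsRes : Ext → Ext → Ext → Set
  IsRes x y z = mulₑ x z ≤ₑ y × (∀ b → mulₑ x b ≤ₑ y → b ≤ₑ z)

  -- Evaluation of a formula in R^S(G) (as a relation, since ∧, ∨, →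
  -- are defined as suprema/infima/maxima);  0 := 1 ,  !a := a ∧ 1.
  data EvalR {L : Lang} (h : ℕ → Ext) : Fm L → Ext → Set where
    evVar : ∀ n → EvalR h (var n) (h n)
    evMeet : ∀ {a b x y z} → EvalR h a x → EvalR h b y → IsMeet x y z → EvalR h (a ∧ᶠ b) z
    evJoin : ∀ {a b x y z} → EvalR h a x → EvalR h b y → IsJoin x y z → EvalR h (a ∨ᶠ b) z
    evMul : ∀ {a b x y} → EvalR h a x → EvalR h b y → EvalR h (a ·ᶠ b) (mulₑ x y)
    evRes : ∀ {a b x y z} → EvalR h a x → EvalR h b y → IsRes x y z → EvalR h (a ⇒ᶠ b) z
    evOne : EvalR h oneᶠ (el ε)
    evZero : ∀ t → EvalR h (zeroᶠ t) (el ε)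
    evBot : ∀ t → EvalR h (botᶠ t) ⊥ₑ
    evTop : ∀ t → EvalR h (topᶠ t) ⊤ₑ
    evBang : ∀ {t a x z} → EvalR h a x → IsMeet x (el ε) z → EvalR h (bangᶠ t a) z

  SatR : {L : Lang} → Fm L → Fm L → Set
  SatR s t = ∀ (h : ℕ → Ext) u v → EvalR h s u → EvalR h t v → u ≃ₑ v

  pow : |G| → ℕ → |G|
  pow x zero    = ε
  pow x (suc n) = x ∙ pow x n

InQ : (ℕ → Set) → AbelianGroup 0ℓ 0ℓ → Set
InQ P G = ∀ p → P p → ∀ x → pow G x p ≈ ε → x ≈ ε
  where open AbelianGroup G

-- Equations valid in K_P^S.  (Trivial algebras satisfy every equation,
-- and validity of equations is invariant under isomorphism, so the
-- equational theory of K_P^S is that of the R^S(G), G ∈ Q_P.)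
ValidK : (P : ℕ → Set) (L : Lang) → Fm L → Fm L → Set₁
ValidK P L s t = ∀ (G : AbelianGroup 0ℓ 0ℓ) → InQ P G → SatR G s t

-- Membership in the variety V_P^S generated by K_P^S
-- (Birkhoff: V(K) = Mod(Eq(K))).
InV : (P : ℕ → Set) (L : Lang) → Alg L → Set₁
InV P L A = ∀ s t → ValidK P L s t → Alg.Sat A s t

Derives : (P : ℕ → Set) (L : Lang) → List (Fm L) → Fm L → Set₁
Derives P L Γ φ =
  ∀ (A : Alg L) → InV P L A → ∀ (h : ℕ → Alg.Carrier A) →
  All (λ γ → Alg.meet A (Alg.eval A h γ) (Alg.one A) ≡ Alg.one A) Γ →
  Alg.meet A (Alg.eval A h φ) (Alg.one A) ≡ Alg.one A

CraigInterpolation : (P : ℕ → Set) (L : Lang) → Set₁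
CraigInterpolation P L =
  ∀ (φ ψ : Fm L) → Derives P L [] (φ ⇒ᶠ ψ) →
  Σ (Fm L) λ δ →
    (∀ n → Occurs n δ → Occurs n φ × Occurs n ψ) ×
    Derives P L [] (φ ⇒ᶠ δ) × Derives P L [] (δ ⇒ᶠ ψ)

-- Take the premise (x ⇔ yᵖ)·y and the conclusion (x ⇔ zᵖ) → z, where u ⇔ v abbreviates
-- (u → v) ∧ (v → u) ∧ 1. In R(G) the guard u ⇔ v is either ⊥ or 1, and it is 1 only when
-- u = v; so whenever both guards are 1 we get yᵖ = x = zᵖ, hence y = z because G has
-- unique p-th roots, and the premise lies below the conclusion. An interpolant δ may only
-- mention x. In R(ℤ) under x ↦ p, y, z ↦ 1 both the premise and the conclusion evaluate
-- to 1, so δ would have to evaluate to 1 as well; but {⊥, ⊤} ∪ pℤ is a subalgebra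
-- containing the value of x, so δ evaluates into it, and 1 ∈ pℤ is impossible for p prime.
module Submission where

open import Level using (0ℓ)
open import Defs
open import Algebra.Bundles using (AbelianGroup)
open import Data.Integer as ℤ using (ℤ; +_; 0ℤ; 1ℤ; _*_)
import Data.Integer.Properties as ℤP
open import Data.Integer.Divisibility.Signed using (_∣_; divides; ∣m∣n⇒∣m+n; ∣m⇒∣-m; ∣⇒∣ᵤ)
open import Data.List using ([])
open import Data.List.Relation.Unary.All using ([])
open import Data.Nat using (ℕ; zero; suc; NonZero)
open import Data.Nat.Divisibility using (∣1⇒≡1)
open import Data.Nat.Primality using (Prime; ¬prime[0]; ¬prime[1]; prime⇒nonZero)
open import Data.Empty using (⊥-elim)
open import Data.Product using (_,_; ∃; proj₁; proj₂)
open import Data.Sum using (_⊎_; inj₁; inj₂)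
open import Relation.Binary.Definitions using (Decidable)
open import Relation.Binary.PropositionalEquality
  using (_≡_; refl; sym; trans; cong; cong₂; subst; subst₂)
open import Relation.Nullary using (¬_; yes; no; contradiction)

_^ᶠ_ : ∀ {L} → Fm L → ℕ → Fm L
s ^ᶠ zero  = oneᶠ
s ^ᶠ suc n = s ·ᶠ (s ^ᶠ n)

_⇔ᶠ_ : ∀ {L} → Fm L → Fm L → Fm L
s ⇔ᶠ t = ((s ⇒ᶠ t) ∧ᶠ (t ⇒ᶠ s)) ∧ᶠ oneᶠ

premise : ∀ {L} → ℕ → Fm L
premise p = (var 0 ⇔ᶠ (var 1 ^ᶠ p)) ·ᶠ var 1

conclusion : ∀ {L} → ℕ → Fm L
conclusion p = (var 0 ⇔ᶠ (var 2 ^ᶠ p)) ⇒ᶠ var 2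

valid⇒derivable : ∀ {P L} {φ ψ : Fm L} →
                  ValidK P L ((φ ⇒ᶠ ψ) ∧ᶠ oneᶠ) oneᶠ → Derives P L [] (φ ⇒ᶠ ψ)
valid⇒derivable valid A A∈V h _ = A∈V _ _ valid h

occurs-^ᶠ : ∀ {L n} {s : Fm L} m → Occurs n (s ^ᶠ m) → Occurs n s
occurs-^ᶠ (suc m) (·l o) = o
occurs-^ᶠ (suc m) (·r o) = occurs-^ᶠ m o

occurs-⇔ᶠ : ∀ {L n} {s t : Fm L} → Occurs n (s ⇔ᶠ t) → Occurs n s ⊎ Occurs n t
occurs-⇔ᶠ (∧l (∧l (⇒l o))) = inj₁ o
occurs-⇔ᶠ (∧l (∧l (⇒r o))) = inj₂ o
occurs-⇔ᶠ (∧l (∧r (⇒l o))) = inj₂ o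
occurs-⇔ᶠ (∧l (∧r (⇒r o))) = inj₁ o

occurs-guard : ∀ {L n} k p → Occurs {L} n (var 0 ⇔ᶠ (var k ^ᶠ p)) → n ≡ 0 ⊎ n ≡ k
occurs-guard k p o with occurs-⇔ᶠ o
... | inj₁ here = inj₁ refl
... | inj₂ o′ with occurs-^ᶠ p o′
... | here = inj₂ refl

occurs-premise : ∀ {L n} p → Occurs {L} n (premise p) → n ≡ 0 ⊎ n ≡ 1
occurs-premise p (·l o)    = occurs-guard 1 p o
occurs-premise p (·r here) = inj₂ refl

occurs-conclusion : ∀ {L n} p → Occurs {L} n (conclusion p) → n ≡ 0 ⊎ n ≡ 2
occurs-conclusion p (⇒l o)    = occurs-guard 2 p o
occurs-conclusion p (⇒r here) = inj₂ refl

shared-variable : ∀ {L n} p → Occurs {L} n (premise p) → Occurs {L} n (conclusion p) → n ≡ 0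
shared-variable p o o′ with occurs-premise p o | occurs-conclusion p o′
... | inj₁ n≡0  | _         = n≡0
... | inj₂ refl | inj₁ ()
... | inj₂ refl | inj₂ ()

record IsSubuniverse {L} (A : Alg L) (S : Alg.Carrier A → Set) : Set where
  open Alg A
  field
    meet-closed : ∀ {x y} → S x → S y → S (meet x y)
    join-closed : ∀ {x y} → S x → S y → S (join x y)
    mul-closed  : ∀ {x y} → S x → S y → S (mul x y)
    res-closed  : ∀ {x y} → S x → S y → S (res x y)
    one-closed  : S one
    zer-closed  : ∀ t → S (zer t)
    bot-closed  : ∀ t → S (bot t)
    top-closed  : ∀ t → S (top t)
    bang-closed : ∀ t {x} → S x → S (bang t x)

eval-closed : ∀ {L} {A : Alg L} {S} → IsSubuniverse A S → ∀ h (δ : Fm L) →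
              (∀ n → Occurs n δ → S (h n)) → S (Alg.eval A h δ)
eval-closed sub h (var n)     hS = hS n here
eval-closed sub h (a ∧ᶠ b)    hS = IsSubuniverse.meet-closed sub
  (eval-closed sub h a (λ n o → hS n (∧l o))) (eval-closed sub h b (λ n o → hS n (∧r o)))
eval-closed sub h (a ∨ᶠ b)    hS = IsSubuniverse.join-closed sub
  (eval-closed sub h a (λ n o → hS n (∨l o))) (eval-closed sub h b (λ n o → hS n (∨r o)))
eval-closed sub h (a ·ᶠ b)    hS = IsSubuniverse.mul-closed sub
  (eval-closed sub h a (λ n o → hS n (·l o))) (eval-closed sub h b (λ n o → hS n (·r o)))
eval-closed sub h (a ⇒ᶠ b)    hS = IsSubuniverse.res-closed sub
  (eval-closed sub h a (λ n o → hS n (⇒l o))) (eval-closed sub h b (λ n o → hS n (⇒r o)))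
eval-closed sub h oneᶠ        hS = IsSubuniverse.one-closed sub
eval-closed sub h (zeroᶠ t)   hS = IsSubuniverse.zer-closed sub t
eval-closed sub h (botᶠ t)    hS = IsSubuniverse.bot-closed sub t
eval-closed sub h (topᶠ t)    hS = IsSubuniverse.top-closed sub t
eval-closed sub h (bangᶠ t a) hS = IsSubuniverse.bang-closed sub t
  (eval-closed sub h a (λ n o → hS n (bng o)))

module ExtProperties (G : AbelianGroup 0ℓ 0ℓ) where
  open AbelianGroup G
    renaming (Carrier to |G|; refl to ≈-refl; sym to ≈-sym; trans to ≈-trans)
  open import Algebra.Properties.Group group using (x∙y⁻¹≈ε⇒x≈y; \\-leftDividesˡ; y≈x\\z)
  open import Algebra.Properties.CommutativeMonoid.Mult commutativeMonoid
    using (×-distrib-+; ×-congʳ; ×-idem) renaming (_×_ to _×ₙ_)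
  open import Relation.Binary.Reasoning.Setoid setoid

  infix  4 _≤_ _≃_
  infixl 7 _·_

  _≤_ : Ext G → Ext G → Set
  _≤_ = _≤ₑ_ G

  _≃_ : Ext G → Ext G → Set
  _≃_ = _≃ₑ_ G

  _·_ : Ext G → Ext G → Ext G
  _·_ = mulₑ G

  ≤-refl : ∀ {x} → x ≤ x
  ≤-refl {⊥ₑ}   = ⊥≤
  ≤-refl {⊤ₑ}   = ≤⊤
  ≤-refl {el a} = el≤ ≈-refl

  ≤-trans : ∀ {x y z} → x ≤ y → y ≤ z → x ≤ z
  ≤-trans ⊥≤        _         = ⊥≤
  ≤-trans _         ≤⊤        = ≤⊤
  ≤-trans (el≤ a≈b) (el≤ b≈c) = el≤ (≈-trans a≈b b≈c)

  ≤-antisym : ∀ {x y} → x ≤ y → y ≤ x → x ≃ y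
  ≤-antisym ⊥≤        ⊥≤ = ⊥≃
  ≤-antisym ≤⊤        ≤⊤ = ⊤≃
  ≤-antisym (el≤ a≈b) _  = el≃ a≈b

  ≃⇒≤ : ∀ {x y} → x ≃ y → x ≤ y
  ≃⇒≤ ⊥≃        = ⊥≤
  ≃⇒≤ ⊤≃        = ≤⊤
  ≃⇒≤ (el≃ a≈b) = el≤ a≈b

  ≃-sym : ∀ {x y} → x ≃ y → y ≃ x
  ≃-sym ⊥≃        = ⊥≃
  ≃-sym ⊤≃        = ⊤≃
  ≃-sym (el≃ a≈b) = el≃ (≈-sym a≈b)

  ≃-trans : ∀ {x y z} → x ≃ y → y ≃ z → x ≃ z
  ≃-trans ⊥≃        ⊥≃        = ⊥≃
  ≃-trans ⊤≃        ⊤≃        = ⊤≃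
  ≃-trans (el≃ a≈b) (el≃ b≈c) = el≃ (≈-trans a≈b b≈c)

  ·-zeroʳ : ∀ x → x · ⊥ₑ ≡ ⊥ₑ
  ·-zeroʳ ⊥ₑ     = refl
  ·-zeroʳ ⊤ₑ     = refl
  ·-zeroʳ (el a) = refl

  ·-identityʳ-≤ : ∀ x → x · el ε ≤ x
  ·-identityʳ-≤ ⊥ₑ     = ⊥≤
  ·-identityʳ-≤ ⊤ₑ     = ≤⊤
  ·-identityʳ-≤ (el a) = el≤ (identityʳ a)

  ≥1⇒·-inflationary : ∀ {r} x → el ε ≤ r → x ≤ x · r
  ≥1⇒·-inflationary ⊥ₑ     _       = ⊥≤
  ≥1⇒·-inflationary ⊤ₑ     ≤⊤      = ≤⊤
  ≥1⇒·-inflationary ⊤ₑ     (el≤ _) = ≤⊤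
  ≥1⇒·-inflationary (el a) ≤⊤      = ≤⊤
  ≥1⇒·-inflationary (el a) (el≤ {b = c} ε≈c) = el≤ (begin
    a     ≈⟨ identityʳ a ⟨
    a ∙ ε ≈⟨ ∙-congˡ ε≈c ⟩
    a ∙ c ∎)

  ≤1⇒·-deflationary : ∀ {e} x → e ≤ el ε → e · x ≤ x
  ≤1⇒·-deflationary _      ⊥≤      = ⊥≤
  ≤1⇒·-deflationary ⊥ₑ     (el≤ _) = ⊥≤
  ≤1⇒·-deflationary ⊤ₑ     (el≤ _) = ≤⊤
  ≤1⇒·-deflationary (el a) (el≤ {a = c} c≈ε) = el≤ (begin
    c ∙ a ≈⟨ ∙-congʳ c≈ε ⟩
    ε ∙ a ≈⟨ identityˡ a ⟩
    a     ∎)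

  ≤1⇒⊥⊎≥1 : ∀ {e} → e ≤ el ε → e ≡ ⊥ₑ ⊎ el ε ≤ e
  ≤1⇒⊥⊎≥1 ⊥≤        = inj₁ refl
  ≤1⇒⊥⊎≥1 (el≤ c≈ε) = inj₂ (el≤ (≈-sym c≈ε))

  res≥1⇒≤ : ∀ {x y r} → IsRes G x y r → el ε ≤ r → x ≤ y
  res≥1⇒≤ {x} (xr≤y , _) 1≤r = ≤-trans (≥1⇒·-inflationary x 1≤r) xr≤y

  ≤⇒res≥1 : ∀ {x y r} → IsRes G x y r → x ≤ y → el ε ≤ r
  ≤⇒res≥1 {x} (_ , maximal) x≤y = maximal (el ε) (≤-trans (·-identityʳ-≤ x) x≤y)

  meet-≥ʳ : ∀ {x y z} → IsMeet G x y z → y ≤ x → z ≃ y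
  meet-≥ʳ (_ , z≤y , greatest) y≤x = ≤-antisym z≤y (greatest _ y≤x ≤-refl)

  NoTorsion : ℕ → Set
  NoTorsion n = ∀ a → pow G a n ≈ ε → a ≈ ε

  pow≡× : ∀ a n → pow G a n ≡ n ×ₙ a
  pow≡× a zero    = refl
  pow≡× a (suc n) = cong (a ∙_) (pow≡× a n)

  pow-injective : ∀ n .{{_ : NonZero n}} → NoTorsion n →
                  ∀ {a b} → pow G a n ≈ pow G b n → a ≈ b
  pow-injective n noTorsion {a} {b} aⁿ≈bⁿ =
    x∙y⁻¹≈ε⇒x≈y a b (noTorsion _ (subst (_≈ ε) (sym (pow≡× (a ∙ b ⁻¹) n)) quotient-vanishes))
    where
    quotient-vanishes : n ×ₙ (a ∙ b ⁻¹) ≈ ε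
    quotient-vanishes = begin
      n ×ₙ (a ∙ b ⁻¹)         ≈⟨ ×-distrib-+ a (b ⁻¹) n ⟩
      n ×ₙ a ∙ n ×ₙ (b ⁻¹)    ≈⟨ ∙-congʳ (subst₂ _≈_ (pow≡× a n) (pow≡× b n) aⁿ≈bⁿ) ⟩
      n ×ₙ b ∙ n ×ₙ (b ⁻¹)    ≈⟨ ×-distrib-+ b (b ⁻¹) n ⟨
      n ×ₙ (b ∙ b ⁻¹)         ≈⟨ ×-congʳ n (inverseʳ b) ⟩
      n ×ₙ ε                  ≈⟨ ×-idem (identityˡ ε) n ⟩
      ε                       ∎

  powₑ : Ext G → ℕ → Ext G
  powₑ x zero    = el ε
  powₑ x (suc n) = x · powₑ x n

  mapₑ : (|G| → |G|) → Ext G → Ext G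
  mapₑ f ⊥ₑ     = ⊥ₑ
  mapₑ f ⊤ₑ     = ⊤ₑ
  mapₑ f (el a) = el (f a)

  mapₑ-injective : ∀ {f} → (∀ {a b} → f a ≈ f b → a ≈ b) →
                   ∀ {x y} → mapₑ f x ≃ mapₑ f y → x ≃ y
  mapₑ-injective f-inj {⊥ₑ}   {⊥ₑ}   _          = ⊥≃
  mapₑ-injective f-inj {⊤ₑ}   {⊤ₑ}   _          = ⊤≃
  mapₑ-injective f-inj {el a} {el b} (el≃ fa≈fb) = el≃ (f-inj fa≈fb)

  powₑ-el : ∀ a n → powₑ (el a) n ≡ el (pow G a n)
  powₑ-el a zero    = refl
  powₑ-el a (suc n) = cong (el a ·_) (powₑ-el a n)

  powₑ-suc : ∀ x q → powₑ x (suc q) ≡ mapₑ (λ a → pow G a (suc q)) x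
  powₑ-suc ⊥ₑ     q       = refl
  powₑ-suc ⊤ₑ     zero    = refl
  powₑ-suc ⊤ₑ     (suc q) = cong (⊤ₑ ·_) (powₑ-suc ⊤ₑ q)
  powₑ-suc (el a) q       = powₑ-el a (suc q)

  powₑ-injective : ∀ n .{{_ : NonZero n}} → NoTorsion n →
                   ∀ {x y} → powₑ x n ≃ powₑ y n → x ≃ y
  powₑ-injective (suc q) noTorsion {x} {y} xⁿ≃yⁿ =
    mapₑ-injective (pow-injective (suc q) noTorsion)
      (subst₂ _≃_ (powₑ-suc x q) (powₑ-suc y q) xⁿ≃yⁿ)

  -- EvalR is a relation (meets and residuals are specified by universal properties), so
  -- a value is pinned down separately.
  Denotes : ∀ {L} → (ℕ → Ext G) → Fm L → Ext G → Set
  Denotes h s u = ∀ {w} → EvalR G h s w → w ≡ u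

  var-denotes : ∀ {L h} n → Denotes {L} h (var n) (h n)
  var-denotes n (evVar .n) = refl

  ^ᶠ-denotes : ∀ {L h} {s : Fm L} {u} → Denotes h s u → ∀ n → Denotes h (s ^ᶠ n) (powₑ u n)
  ^ᶠ-denotes s↦u zero    evOne         = refl
  ^ᶠ-denotes s↦u (suc n) (evMul ds dsⁿ) = cong₂ _·_ (s↦u ds) (^ᶠ-denotes s↦u n dsⁿ)

  ⇔ᶠ-≤1 : ∀ {L h} {s t : Fm L} {e} → EvalR G h (s ⇔ᶠ t) e → e ≤ el ε
  ⇔ᶠ-≤1 (evMeet _ evOne (_ , e≤1 , _)) = e≤1

  ⇔ᶠ-≥1⇒≃ : ∀ {L h} {s t : Fm L} {u v e} → Denotes h s u → Denotes h t v →
            EvalR G h (s ⇔ᶠ t) e → el ε ≤ e → u ≃ v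
  ⇔ᶠ-≥1⇒≃ s↦u t↦v (evMeet (evMeet {z = g} (evRes ds dt st) (evRes dt′ ds′ ts) m) evOne m₁) 1≤e
    with s↦u ds | t↦v dt | t↦v dt′ | s↦u ds′
  ... | refl | refl | refl | refl =
    ≤-antisym (res≥1⇒≤ st (1≤ (proj₁ m))) (res≥1⇒≤ ts (1≤ (proj₁ (proj₂ m))))
    where
    1≤ : ∀ {r} → g ≤ r → el ε ≤ r
    1≤ g≤r = ≤-trans (≤-trans 1≤e (proj₁ m₁)) g≤r

  -- Both guards are ⊥ or 1; if both are 1 then y and z are p-th roots of x.
  guards-transport : ∀ {L} p .{{_ : NonZero p}} → NoTorsion p → ∀ h {e₁ e₂} →
                     EvalR G {L} h (var 0 ⇔ᶠ (var 1 ^ᶠ p)) e₁ →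
                     EvalR G {L} h (var 0 ⇔ᶠ (var 2 ^ᶠ p)) e₂ →
                     e₂ · (e₁ · h 1) ≤ h 2
  guards-transport {L} p noTorsion h {e₁} {e₂} guard₁ guard₂
    with ≤1⇒⊥⊎≥1 (⇔ᶠ-≤1 guard₁) | ≤1⇒⊥⊎≥1 (⇔ᶠ-≤1 guard₂)
  ... | inj₁ refl | _         rewrite ·-zeroʳ e₂ = ⊥≤
  ... | inj₂ _    | inj₁ refl = ⊥≤
  ... | inj₂ 1≤e₁ | inj₂ 1≤e₂ =
    ≤-trans (≤1⇒·-deflationary _ (⇔ᶠ-≤1 guard₂))
      (≤-trans (≤1⇒·-deflationary _ (⇔ᶠ-≤1 guard₁)) (≃⇒≤ y≃z))
    where
    root : ∀ k {e} → EvalR G {L} h (var 0 ⇔ᶠ (var k ^ᶠ p)) e → el ε ≤ e → h 0 ≃ powₑ (h k) p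
    root k guard = ⇔ᶠ-≥1⇒≃ (var-denotes 0) (^ᶠ-denotes (var-denotes k) p) guard
    y≃z : h 1 ≃ h 2
    y≃z = powₑ-injective p noTorsion (≃-trans (≃-sym (root 1 guard₁ 1≤e₁)) (root 2 guard₂ 1≤e₂))

  premise≤conclusion : ∀ {L} p .{{_ : NonZero p}} → NoTorsion p →
                       SatR G {L} ((premise p ⇒ᶠ conclusion p) ∧ᶠ oneᶠ) oneᶠ
  premise≤conclusion p noTorsion h u .(el ε)
    (evMeet (evRes (evMul guard₁ (evVar 1)) (evRes guard₂ (evVar 2) z-res) implication) evOne m) evOne =
    meet-≥ʳ m (≤⇒res≥1 implication
      (proj₂ z-res _ (guards-transport p noTorsion h guard₁ guard₂)))

  module Standard (_≟_ : Decidable _≈_) where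

    meetₑ : Ext G → Ext G → Ext G
    meetₑ ⊥ₑ     y      = ⊥ₑ
    meetₑ ⊤ₑ     y      = y
    meetₑ (el a) ⊥ₑ     = ⊥ₑ
    meetₑ (el a) ⊤ₑ     = el a
    meetₑ (el a) (el b) with a ≟ b
    ... | yes _ = el a
    ... | no  _ = ⊥ₑ

    joinₑ : Ext G → Ext G → Ext G
    joinₑ ⊥ₑ     y      = y
    joinₑ ⊤ₑ     y      = ⊤ₑ
    joinₑ (el a) ⊥ₑ     = el a
    joinₑ (el a) ⊤ₑ     = ⊤ₑ
    joinₑ (el a) (el b) with a ≟ b
    ... | yes _ = el a
    ... | no  _ = ⊤ₑ

    resₑ : Ext G → Ext G → Ext G
    resₑ ⊥ₑ     y      = ⊤ₑ
    resₑ ⊤ₑ     ⊤ₑ     = ⊤ₑ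
    resₑ ⊤ₑ     _      = ⊥ₑ
    resₑ (el a) ⊥ₑ     = ⊥ₑ
    resₑ (el a) ⊤ₑ     = ⊤ₑ
    resₑ (el a) (el b) = el (a ⁻¹ ∙ b)

    meetₑ-isMeet : ∀ x y → IsMeet G x y (meetₑ x y)
    meetₑ-isMeet ⊥ₑ     y      = ⊥≤ , ⊥≤ , λ _ w≤⊥ _ → w≤⊥
    meetₑ-isMeet ⊤ₑ     y      = ≤⊤ , ≤-refl , λ _ _ w≤y → w≤y
    meetₑ-isMeet (el a) ⊥ₑ     = ⊥≤ , ⊥≤ , λ _ _ w≤⊥ → w≤⊥
    meetₑ-isMeet (el a) ⊤ₑ     = ≤-refl , ≤⊤ , λ _ w≤a _ → w≤a
    meetₑ-isMeet (el a) (el b) with a ≟ b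
    ... | yes a≈b = ≤-refl , el≤ a≈b , λ _ w≤a _ → w≤a
    ... | no  a≉b = ⊥≤ , ⊥≤ , greatest
      where
      greatest : ∀ w → w ≤ el a → w ≤ el b → w ≤ ⊥ₑ
      greatest _ ⊥≤        _         = ⊥≤
      greatest _ (el≤ c≈a) (el≤ c≈b) = contradiction (≈-trans (≈-sym c≈a) c≈b) a≉b

    joinₑ-isJoin : ∀ x y → IsJoin G x y (joinₑ x y)
    joinₑ-isJoin ⊥ₑ     y      = ⊥≤ , ≤-refl , λ _ _ y≤w → y≤w
    joinₑ-isJoin ⊤ₑ     y      = ≤⊤ , ≤⊤ , λ _ ⊤≤w _ → ⊤≤w
    joinₑ-isJoin (el a) ⊥ₑ     = ≤-refl , ⊥≤ , λ _ a≤w _ → a≤w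
    joinₑ-isJoin (el a) ⊤ₑ     = ≤⊤ , ≤⊤ , λ _ _ ⊤≤w → ⊤≤w
    joinₑ-isJoin (el a) (el b) with a ≟ b
    ... | yes a≈b = ≤-refl , el≤ (≈-sym a≈b) , λ _ a≤w _ → a≤w
    ... | no  a≉b = ≤⊤ , ≤⊤ , least
      where
      least : ∀ w → el a ≤ w → el b ≤ w → ⊤ₑ ≤ w
      least _ ≤⊤        _         = ≤⊤
      least _ (el≤ a≈c) (el≤ b≈c) = contradiction (≈-trans a≈c (≈-sym b≈c)) a≉b

    resₑ-isRes : ∀ x y → IsRes G x y (resₑ x y)
    resₑ-isRes ⊥ₑ     y      = ⊥≤ , λ _ _ → ≤⊤
    resₑ-isRes ⊤ₑ     ⊤ₑ     = ≤⊤ , λ _ _ → ≤⊤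
    resₑ-isRes ⊤ₑ     ⊥ₑ     = ⊥≤ , λ { ⊥ₑ _ → ⊥≤ }
    resₑ-isRes ⊤ₑ     (el c) = ⊥≤ , λ { ⊥ₑ _ → ⊥≤ }
    resₑ-isRes (el a) ⊥ₑ     = ⊥≤ , λ { ⊥ₑ _ → ⊥≤ }
    resₑ-isRes (el a) ⊤ₑ     = ≤⊤ , λ _ _ → ≤⊤
    resₑ-isRes (el a) (el b) = el≤ (\\-leftDividesˡ a b) , maximal
      where
      maximal : ∀ c → el a · c ≤ el b → c ≤ el (a ⁻¹ ∙ b)
      maximal ⊥ₑ     _          = ⊥≤
      maximal (el c) (el≤ ac≈b) = el≤ (y≈x\\z a c b ac≈b)

    R : (L : Lang) → Alg L
    R L = record
      { Carrier = Ext G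
      ; meet    = meetₑ
      ; join    = joinₑ
      ; mul     = _·_
      ; res     = resₑ
      ; one     = el ε
      ; zer     = λ _ → el ε
      ; bot     = λ _ → ⊥ₑ
      ; top     = λ _ → ⊤ₑ
      ; bang    = λ _ x → meetₑ x (el ε)
      }

    eval-EvalR : ∀ {L} h (δ : Fm L) → EvalR G h δ (Alg.eval (R L) h δ)
    eval-EvalR h (var n)     = evVar n
    eval-EvalR h (a ∧ᶠ b)    = evMeet (eval-EvalR h a) (eval-EvalR h b) (meetₑ-isMeet _ _)
    eval-EvalR h (a ∨ᶠ b)    = evJoin (eval-EvalR h a) (eval-EvalR h b) (joinₑ-isJoin _ _)
    eval-EvalR h (a ·ᶠ b)    = evMul (eval-EvalR h a) (eval-EvalR h b)
    eval-EvalR h (a ⇒ᶠ b)    = evRes (eval-EvalR h a) (eval-EvalR h b) (resₑ-isRes _ _)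
    eval-EvalR h oneᶠ        = evOne
    eval-EvalR h (zeroᶠ t)   = evZero t
    eval-EvalR h (botᶠ t)    = evBot t
    eval-EvalR h (topᶠ t)    = evTop t
    eval-EvalR h (bangᶠ t a) = evBang (eval-EvalR h a) (meetₑ-isMeet _ _)

    eval-^ᶠ : ∀ {L} h (s : Fm L) n → Alg.eval (R L) h (s ^ᶠ n) ≡ powₑ (Alg.eval (R L) h s) n
    eval-^ᶠ h s zero    = refl
    eval-^ᶠ h s (suc n) = cong (Alg.eval (R _) h s ·_) (eval-^ᶠ h s n)

    R∈V : (∀ {a b} → a ≈ b → a ≡ b) → ∀ {P} L → InQ P G → InV P L (R L)
    R∈V ≈⇒≡ L G∈Q s t valid h = ≃⇒≡ (valid G G∈Q h _ _ (eval-EvalR h s) (eval-EvalR h t))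
      where
      ≃⇒≡ : ∀ {x y} → x ≃ y → x ≡ y
      ≃⇒≡ ⊥≃        = refl
      ≃⇒≡ ⊤≃        = refl
      ≃⇒≡ (el≃ a≈b) = cong el (≈⇒≡ a≈b)

    derivable⇒≤ : ∀ {P L} → InV P L (R L) → ∀ (φ ψ : Fm L) → Derives P L [] (φ ⇒ᶠ ψ) →
                  ∀ h → Alg.eval (R L) h φ ≤ Alg.eval (R L) h ψ
    derivable⇒≤ {L = L} ℤ-R∈V φ ψ φ⊢ψ h = res≥1⇒≤ (resₑ-isRes x y)
      (subst (_≤ resₑ x y) (φ⊢ψ (R L) ℤ-R∈V h []) (proj₁ (meetₑ-isMeet (resₑ x y) (el ε))))
      where
      x y : Ext G
      x = Alg.eval (R L) h φ
      y = Alg.eval (R L) h ψ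

    data Bounded (H : |G| → Set) : Ext G → Set where
      ⊥∈ : Bounded H ⊥ₑ
      ⊤∈ : Bounded H ⊤ₑ
      el∈ : ∀ {a} → H a → Bounded H (el a)

    subgroup-subuniverse : ∀ {H} → H ε → (∀ {a b} → H a → H b → H (a ∙ b)) →
                           (∀ {a} → H a → H (a ⁻¹)) → ∀ L → IsSubuniverse (R L) (Bounded H)
    subgroup-subuniverse {H} ε∈H ∙-closed ⁻¹-closed L = record
      { meet-closed = meet-closed
      ; join-closed = join-closed
      ; mul-closed  = mul-closed
      ; res-closed  = res-closed
      ; one-closed  = el∈ ε∈H
      ; zer-closed  = λ _ → el∈ ε∈H
      ; bot-closed  = λ _ → ⊥∈
      ; top-closed  = λ _ → ⊤∈
      ; bang-closed = λ _ x∈ → meet-closed x∈ (el∈ ε∈H)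
      }
      where
      meet-closed : ∀ {x y} → Bounded H x → Bounded H y → Bounded H (meetₑ x y)
      meet-closed ⊥∈ _  = ⊥∈
      meet-closed ⊤∈ y∈ = y∈
      meet-closed (el∈ a∈) ⊥∈ = ⊥∈
      meet-closed (el∈ a∈) ⊤∈ = el∈ a∈
      meet-closed (el∈ {a} a∈) (el∈ {b} _) with a ≟ b
      ... | yes _ = el∈ a∈
      ... | no  _ = ⊥∈

      join-closed : ∀ {x y} → Bounded H x → Bounded H y → Bounded H (joinₑ x y)
      join-closed ⊥∈ y∈ = y∈
      join-closed ⊤∈ _  = ⊤∈
      join-closed (el∈ a∈) ⊥∈ = el∈ a∈
      join-closed (el∈ a∈) ⊤∈ = ⊤∈
      join-closed (el∈ {a} a∈) (el∈ {b} _) with a ≟ b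
      ... | yes _ = el∈ a∈
      ... | no  _ = ⊤∈

      mul-closed : ∀ {x y} → Bounded H x → Bounded H y → Bounded H (x · y)
      mul-closed ⊥∈ _  = ⊥∈
      mul-closed ⊤∈ ⊥∈ = ⊥∈
      mul-closed ⊤∈ ⊤∈ = ⊤∈
      mul-closed ⊤∈ (el∈ _) = ⊤∈
      mul-closed (el∈ _) ⊥∈ = ⊥∈
      mul-closed (el∈ _) ⊤∈ = ⊤∈
      mul-closed (el∈ a∈) (el∈ b∈) = el∈ (∙-closed a∈ b∈)

      res-closed : ∀ {x y} → Bounded H x → Bounded H y → Bounded H (resₑ x y)
      res-closed ⊥∈ _  = ⊤∈
      res-closed ⊤∈ ⊥∈ = ⊥∈
      res-closed ⊤∈ ⊤∈ = ⊤∈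
      res-closed ⊤∈ (el∈ _) = ⊥∈
      res-closed (el∈ _) ⊥∈ = ⊥∈
      res-closed (el∈ _) ⊤∈ = ⊤∈
      res-closed (el∈ a∈) (el∈ b∈) = el∈ (∙-closed (⁻¹-closed a∈) b∈)

ℤ-group : AbelianGroup 0ℓ 0ℓ
ℤ-group = ℤP.+-0-abelianGroup

open ExtProperties ℤ-group using (_≤_; powₑ-el)
open ExtProperties.Standard ℤ-group ℤ._≟_

pow-ℤ : ∀ a n → pow ℤ-group a n ≡ + n * a
pow-ℤ a zero    = refl
pow-ℤ a (suc n) = begin
  a ℤ.+ pow ℤ-group a n ≡⟨ cong₂ ℤ._+_ (sym (ℤP.*-identityˡ a)) (pow-ℤ a n) ⟩
  1ℤ * a ℤ.+ + n * a    ≡⟨ ℤP.*-distribʳ-+ a 1ℤ (+ n) ⟨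
  + suc n * a           ∎
  where open Relation.Binary.PropositionalEquality.≡-Reasoning

ℤ∈Q : ∀ {P} → (∀ p → P p → Prime p) → InQ P ℤ-group
ℤ∈Q primes p p∈P a pᵃ≡0 with ℤP.i*j≡0⇒i≡0∨j≡0 (+ p) (trans (sym (pow-ℤ a p)) pᵃ≡0)
... | inj₂ a≡0 = a≡0
... | inj₁ p≡0 = ⊥-elim (¬prime[0] (subst Prime (ℤP.+-injective p≡0) (primes p p∈P)))

Multiple : ℕ → ℤ → Set
Multiple p a = + p ∣ a

multiples-subuniverse : ∀ p L → IsSubuniverse (R L) (Bounded (Multiple p))
multiples-subuniverse p = subgroup-subuniverse (divides 0ℤ refl) ∣m∣n⇒∣m+n ∣m⇒∣-m

h₀ : ℕ → ℕ → Ext ℤ-group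
h₀ p zero    = el (+ p)
h₀ p (suc _) = el 1ℤ

eval-guard : ∀ {L} p k → Alg.eval (R L) (h₀ p) (var 0 ⇔ᶠ (var (suc k) ^ᶠ p)) ≡ el 0ℤ
eval-guard {L} p k
  rewrite eval-^ᶠ (h₀ p) (var {L} (suc k)) p | powₑ-el 1ℤ p | pow-ℤ 1ℤ p
        | ℤP.*-identityʳ (+ p) | ℤP.+-inverseˡ (+ p) = refl

eval-premise : ∀ {L} p → Alg.eval (R L) (h₀ p) (premise p) ≡ el 1ℤ
eval-premise {L} p rewrite eval-guard {L} p 0 = refl

eval-conclusion : ∀ {L} p → Alg.eval (R L) (h₀ p) (conclusion p) ≡ el 1ℤ
eval-conclusion {L} p rewrite eval-guard {L} p 1 = refl

interpolant⇒p≡1 : ∀ {L} p (δ : Fm L) → (∀ n → Occurs n δ → n ≡ 0) →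
                  Alg.eval (R L) (h₀ p) (premise p) ≤ Alg.eval (R L) (h₀ p) δ →
                  Alg.eval (R L) (h₀ p) δ ≤ Alg.eval (R L) (h₀ p) (conclusion p) →
                  p ≡ 1
interpolant⇒p≡1 {L} p δ only-x premise≤δ δ≤conclusion
  rewrite eval-premise {L} p | eval-conclusion {L} p =
  between (eval-closed (multiples-subuniverse p L) (h₀ p) δ x-multiple) premise≤δ δ≤conclusion
  where
  x-multiple : ∀ n → Occurs n δ → Bounded (Multiple p) (h₀ p n)
  x-multiple n o rewrite only-x n o = el∈ (divides 1ℤ (sym (ℤP.*-identityˡ (+ p))))
  between : ∀ {d} → Bounded (Multiple p) d → el 1ℤ ≤ d → d ≤ el 1ℤ → p ≡ 1
  between (el∈ p∣1) (el≤ refl) _ = ∣1⇒≡1 (∣⇒∣ᵤ p∣1)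

corollary3p14 : (P : ℕ → Set) → (∀ p → P p → Prime p) → ∃ P →
    ∀ (L : Lang) → ¬ CraigInterpolation P L
corollary3p14 P primes (p , p∈P) L craig
  with craig (premise p) (conclusion p)
         (valid⇒derivable λ G G∈Q →
           ExtProperties.premise≤conclusion G p {{prime⇒nonZero (primes p p∈P)}} (G∈Q p p∈P))
... | δ , shared , premise⊢δ , δ⊢conclusion =
  ¬prime[1] (subst Prime p≡1 (primes p p∈P))
  where
  ℤ-R∈V : InV P L (R L)
  ℤ-R∈V = R∈V (λ a≡b → a≡b) L (ℤ∈Q primes)
  p≡1 : p ≡ 1
  p≡1 = interpolant⇒p≡1 p δ (λ n o → shared-variable p (proj₁ (shared n o)) (proj₂ (shared n o)))
          (derivable⇒≤ ℤ-R∈V (premise p) δ premise⊢δ (h₀ p))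
          (derivable⇒≤ ℤ-R∈V δ (conclusion p) δ⊢conclusion (h₀ p))
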